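{- If $G$ is a connected graph of order at least $2$, then $b_{dR}(G)\leq \Delta(G)+\delta(G)-1$.
   Context: All graphs are finite, simple and undirected. $\delta(G)$ and $\Delta(G)$ denote the minimum and maximum degree of $G$. For a graph $G=(V,E)$, a double Roman dominating function (DRDF) is a function $f:V\to\{0,1,2,3\}$ such that every vertex $v$ with $f(v)=0$ has at least two neighbors $u$ with $f(u)=2$ or at least one neighbor $w$ with $f(w)=3$, and every vertex $v$ with $f(v)=1$ has at least one neighbor $w$ with $f(w)\geq 2$. The weight of $f$ is $\sum_{u\in V}f(u)$, and $\gamma_{dR}(G)$ is the minimum weight of a DRDF on $G$. The double Roman bondage number $b_{dR}(G)$ is the minimum cardinality of an edge set $B\subseteq E(G)$ such that $\gamma_{dR}(G-B)>\gamma_{dR}(G)$. -}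

module Defs where

open import Data.Nat using (ℕ; zero; suc; _+_; _≤_; _<_; _⊔_; _⊓_; _<ᵇ_)
open import Data.Bool using (Bool; true; false; _∧_; not; if_then_else_)
open import Data.Fin using (Fin; toℕ)
open import Data.List using (List; map; foldr; allFin)
open import Data.Nat.ListAction using (sum)
open import Data.Product using (Σ; ∃; _×_; _,_)
open import Data.Sum using (_⊎_)
open import Relation.Binary.PropositionalEquality using (_≡_; _≢_)

record Graph (n : ℕ) : Set where
  field
    adj    : Fin n → Fin n → Bool
    sym    : ∀ i j → adj i j ≡ adj j i
    irrefl : ∀ i → adj i i ≡ false
open Graph public

countᵇ : {A : Set} → (A → Bool) → List A → ℕ
countᵇ p = foldr (λ x acc → if p x then suc acc else acc) 0

deg : ∀ {n} → Graph n → Fin n → ℕ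
deg {n} G v = countᵇ (adj G v) (allFin n)

Δ : ∀ {n} → Graph n → ℕ
Δ {n} G = foldr _⊔_ 0 (map (deg G) (allFin n))

-- minimum degree δ(G) (meaningful for n ≥ 1; the initial value Δ(G) is an upper bound)
δ : ∀ {n} → Graph n → ℕ
δ {n} G = foldr _⊓_ (Δ G) (map (deg G) (allFin n))

data Reach {n} (G : Graph n) : Fin n → Fin n → Set where
  here : ∀ {u} → Reach G u u
  step : ∀ {u w v} → adj G u w ≡ true → Reach G w v → Reach G u v

Connected : ∀ {n} → Graph n → Set
Connected {n} G = ∀ (u v : Fin n) → Reach G u v

record EdgeSet {n} (G : Graph n) : Set where
  field
    mem    : Fin n → Fin n → Bool
    memSym : ∀ i j → mem i j ≡ mem j i
    sub    : ∀ i j → mem i j ≡ true → adj G i j ≡ true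
open EdgeSet public

∣_∣ₑ : ∀ {n} {G : Graph n} → EdgeSet G → ℕ
∣_∣ₑ {n} B = sum (map (λ i → countᵇ (λ j → mem B i j ∧ (toℕ i <ᵇ toℕ j)) (allFin n)) (allFin n))

removeEdges : ∀ {n} (G : Graph n) → EdgeSet G → Graph n
removeEdges G B = record
  { adj    = λ i j → adj G i j ∧ not (mem B i j)
  ; sym    = λ i j → symH i j
  ; irrefl = λ i → irrH i
  }
  where
  open import Relation.Binary.PropositionalEquality using (cong₂)
  symH : ∀ i j → (adj G i j ∧ not (mem B i j)) ≡ (adj G j i ∧ not (mem B j i))
  symH i j = cong₂ (λ a b → a ∧ not b) (sym G i j) (memSym B i j)
  irrH : ∀ i → (adj G i i ∧ not (mem B i i)) ≡ false
  irrH i with adj G i i | irrefl G i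
  ... | .false | _≡_.refl = _≡_.refl

IsDRDF : ∀ {n} → Graph n → (Fin n → ℕ) → Set
IsDRDF {n} G f =
  (∀ v → f v ≤ 3) ×
  (∀ v → f v ≡ 0 →
     (Σ (Fin n) λ u → Σ (Fin n) λ w →
        u ≢ w × adj G v u ≡ true × adj G v w ≡ true × f u ≡ 2 × f w ≡ 2)
     ⊎ (Σ (Fin n) λ w → adj G v w ≡ true × f w ≡ 3)) ×
  (∀ v → f v ≡ 1 → Σ (Fin n) λ w → adj G v w ≡ true × 2 ≤ f w)

weight : ∀ {n} → (Fin n → ℕ) → ℕ
weight {n} f = sum (map f (allFin n))

IsγdR : ∀ {n} → Graph n → ℕ → Set
IsγdR {n} G k =
  (Σ (Fin n → ℕ) λ f → IsDRDF G f × weight f ≡ k) ×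
  (∀ (f : Fin n → ℕ) → IsDRDF G f → k ≤ weight f)

BondageAtMost : ∀ {n} → Graph n → ℕ → Set
BondageAtMost G m =
  Σ (EdgeSet G) λ B → ∣ B ∣ₑ ≤ m ×
    (∀ k k' → IsγdR G k → IsγdR (removeEdges G B) k' → k < k')

-- Take a vertex u of minimum degree and a neighbour v, and delete the set B of all edges at u or
-- at v; it has deg u + deg v − 1 elements, the edge uv being the only one at both. In G − B the
-- vertices u and v are isolated, so every double Roman dominating function f of G − B has
-- f(u), f(v) ≥ 2. Changing f to 3 at u and to 0 at v gives a double Roman dominating function
-- of G (v is dominated by u; every other vertex keeps its neighbourhood in G − B, which avoids
-- u and v) whose weight is smaller by at least 1. Hence γ_dR(G) < γ_dR(G − B).
module Submission where

open import Defs
open import Data.Nat using (ℕ; zero; suc; z≤n; s≤s; _≤_; _<_; _+_; _∸_; _<ᵇ_)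
open import Data.Nat.Properties
  using ( ≤-refl; ≤-reflexive; ≤-trans; ≤-antisym; <-asym; <-cmp; ≮⇒≥; <⇒<ᵇ; <ᵇ-reflects-<
        ; +-comm; +-suc; +-identityʳ; m≤m+n; +-mono-≤; +-monoˡ-≤; +-monoʳ-≤; +-cancelʳ-≤
        ; m⊔n≤o⇒m≤o; m⊔n≤o⇒n≤o; ⊓-sel; m+n≤o⇒m≤o∸n; ∸-monoˡ-≤
        ; +-0-commutativeMonoid; module ≤-Reasoning )
open import Data.Nat.ListAction renaming (sum to listSum)
open import Data.Bool.Base using (Bool; true; false; _∧_; _∨_; if_then_else_)
open import Data.Bool.Properties using (∨-comm; ∨-zeroʳ; T-≡)
open import Data.Fin.Base using (Fin; zero; suc; toℕ; punchIn)
open import Data.Fin.Properties using (_≟_; toℕ-injective; punchInᵢ≢i)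
open import Data.List.Base using (map; tabulate; allFin)
open import Data.List.Properties using (foldr-forcesᵇ)
open import Data.List.Membership.Propositional.Properties using (∈-allFin; ∈-map⁻; foldr-selective)
open import Data.List.Relation.Unary.All as All using (All)
import Data.List.Relation.Unary.All.Properties as All
open import Data.Product.Base using (∃; _×_; _,_; proj₁; proj₂)
open import Data.Sum.Base using (_⊎_; inj₁; inj₂)
open import Function.Base using (id; _∘_)
open import Function.Bundles using (Equivalence)
open import Relation.Binary.Definitions using (tri<; tri≈; tri>)
open import Relation.Binary.PropositionalEquality as ≡
  using (_≡_; _≢_; refl; cong; cong₂; trans; subst; module ≡-Reasoning)
open import Relation.Nullary.Decidable using (yes; no; does; dec-true; dec-false)
open import Relation.Nullary.Negation using (contradiction)
open import Relation.Nullary.Reflects using (ofʸ; ofⁿ)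
open import Algebra.Properties.CommutativeMonoid.Sum +-0-commutativeMonoid
  using (sum; sum-syntax; ∑-comm; ∑-distrib-+; sum-remove; sum-cong-≗; sum-replicate-zero)

𝟙 : Bool → ℕ
𝟙 b = if b then 1 else 0

listSum-map-tabulate : ∀ {m k} (f : Fin k → ℕ) (g : Fin m → Fin k) →
  listSum (map f (tabulate g)) ≡ sum (f ∘ g)
listSum-map-tabulate {zero}  f g = refl
listSum-map-tabulate {suc m} f g = cong (f (g zero) +_) (listSum-map-tabulate f (g ∘ suc))

countᵇ-tabulate : ∀ {m k} (p : Fin k → Bool) (g : Fin m → Fin k) →
  countᵇ p (tabulate g) ≡ sum (𝟙 ∘ p ∘ g)
countᵇ-tabulate {zero}  p g = refl
countᵇ-tabulate {suc m} p g with p (g zero)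
... | true  = cong suc (countᵇ-tabulate p (g ∘ suc))
... | false = countᵇ-tabulate p (g ∘ suc)

sum-mono-≤ : ∀ {n} {f g : Fin n → ℕ} → (∀ i → f i ≤ g i) → sum f ≤ sum g
sum-mono-≤ {zero}  f≤g = z≤n
sum-mono-≤ {suc n} f≤g = +-mono-≤ (f≤g zero) (sum-mono-≤ (f≤g ∘ suc))

term≤sum : ∀ {n} (f : Fin n → ℕ) (i : Fin n) → f i ≤ sum f
term≤sum {suc n} f i = ≤-trans (m≤m+n (f i) _) (≤-reflexive (≡.sym (sum-remove {i = i} f)))

sum-single : ∀ {n} (f : Fin n → ℕ) (x : Fin n) → (∀ i → i ≢ x → f i ≡ 0) → sum f ≡ f x
sum-single {suc n} f x vanish = begin
  sum f                      ≡⟨ sum-remove {i = x} f ⟩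
  f x + sum (f ∘ punchIn x)  ≡⟨ cong (f x +_) (sum-cong-≗ (λ k → vanish _ (punchInᵢ≢i x k))) ⟩
  f x + sum {n} (λ _ → 0)    ≡⟨ cong (f x +_) (sum-replicate-zero n) ⟩
  f x + 0                    ≡⟨ +-identityʳ (f x) ⟩
  f x                        ∎
  where open ≡-Reasoning

sum-at : ∀ {n} (x : Fin n) (f : Fin n → ℕ) → ∑[ i < n ] (if does (i ≟ x) then f i else 0) ≡ f x
sum-at x f = trans (sum-single _ x vanish) (cong (λ b → if b then f x else 0) (dec-true (x ≟ x) refl))
  where
  vanish : ∀ i → i ≢ x → (if does (i ≟ x) then f i else 0) ≡ 0
  vanish i i≢x rewrite dec-false (i ≟ x) i≢x = refl

sum₂ : ∀ {n} → (Fin n → Fin n → ℕ) → ℕ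
sum₂ {n} f = ∑[ i < n ] ∑[ j < n ] f i j

sum₂-cong : ∀ {n} {f g : Fin n → Fin n → ℕ} → (∀ i j → f i j ≡ g i j) → sum₂ f ≡ sum₂ g
sum₂-cong f≡g = sum-cong-≗ (λ i → sum-cong-≗ (f≡g i))

sum₂-distrib-+ : ∀ {n} (f g : Fin n → Fin n → ℕ) → sum₂ (λ i j → f i j + g i j) ≡ sum₂ f + sum₂ g
sum₂-distrib-+ f g = trans (sum-cong-≗ (λ i → ∑-distrib-+ (f i) (g i))) (∑-distrib-+ (sum ∘ f) (sum ∘ g))

_≺_ : ∀ {n} → Fin n → Fin n → Bool
i ≺ j = toℕ i <ᵇ toℕ j

weight≡sum : ∀ {n} (f : Fin n → ℕ) → weight f ≡ sum f
weight≡sum f = listSum-map-tabulate f id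

deg≡sum : ∀ {n} (G : Graph n) (x : Fin n) → deg G x ≡ ∑[ j < n ] 𝟙 (adj G x j)
deg≡sum G x = countᵇ-tabulate (adj G x) id

∣∣ₑ≡sum₂ : ∀ {n} {G : Graph n} (B : EdgeSet G) → ∣ B ∣ₑ ≡ sum₂ (λ i j → 𝟙 (mem B i j ∧ i ≺ j))
∣∣ₑ≡sum₂ {n} B = trans (listSum-map-tabulate (λ i → countᵇ (λ j → mem B i j ∧ i ≺ j) (allFin n)) id)
                       (sum-cong-≗ (λ i → countᵇ-tabulate (λ j → mem B i j ∧ i ≺ j) id))

𝟙-∨+𝟙-∧ : ∀ s t c → 𝟙 ((s ∨ t) ∧ c) + 𝟙 ((s ∧ t) ∧ c) ≡ 𝟙 (s ∧ c) + 𝟙 (t ∧ c)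
𝟙-∨+𝟙-∧ true  t     c = refl
𝟙-∨+𝟙-∧ false true  c = +-comm (𝟙 c) 0
𝟙-∨+𝟙-∧ false false c = refl

𝟙<ᵇ+𝟙>ᵇ : ∀ {m n} → m ≢ n → 𝟙 (m <ᵇ n) + 𝟙 (n <ᵇ m) ≡ 1
𝟙<ᵇ+𝟙>ᵇ {m} {n} m≢n with m <ᵇ n | <ᵇ-reflects-< m n | n <ᵇ m | <ᵇ-reflects-< n m
... | true  | ofʸ m<n | true  | ofʸ n<m = contradiction n<m (<-asym m<n)
... | true  | _       | false | _       = refl
... | false | _       | true  | _       = refl
... | false | ofⁿ m≮n | false | ofⁿ n≮m = contradiction (≤-antisym (≮⇒≥ n≮m) (≮⇒≥ m≮n)) m≢n

𝟙-∧≺+𝟙-∧≻ : ∀ {n} {i j : Fin n} (b : Bool) → i ≢ j → 𝟙 (b ∧ i ≺ j) + 𝟙 (b ∧ j ≺ i) ≡ 𝟙 b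
𝟙-∧≺+𝟙-∧≻ false i≢j = refl
𝟙-∧≺+𝟙-∧≻ true  i≢j = 𝟙<ᵇ+𝟙>ᵇ (i≢j ∘ toℕ-injective)

∧-true⇒ˡ : ∀ {x y} → x ∧ y ≡ true → x ≡ true
∧-true⇒ˡ {true} _ = refl

∧-true⇒ʳ : ∀ {x y} → x ∧ y ≡ true → y ≡ true
∧-true⇒ʳ {true} y≡true = y≡true

edge⇒≢ : ∀ {n} (G : Graph n) {i j : Fin n} → adj G i j ≡ true → i ≢ j
edge⇒≢ G {i} ij∈G refl = contradiction (trans (≡.sym ij∈G) (irrefl G i)) λ ()

module _ {n} {G : Graph n} where

  _∪ₑ_ : EdgeSet G → EdgeSet G → EdgeSet G
  B₁ ∪ₑ B₂ = record
    { mem    = λ i j → mem B₁ i j ∨ mem B₂ i j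
    ; memSym = λ i j → cong₂ _∨_ (memSym B₁ i j) (memSym B₂ i j)
    ; sub    = ∪-sub
    }
    where
    ∪-sub : ∀ i j → mem B₁ i j ∨ mem B₂ i j ≡ true → adj G i j ≡ true
    ∪-sub i j ij∈B with mem B₁ i j in ij∈B₁
    ... | true  = sub B₁ i j ij∈B₁
    ... | false = sub B₂ i j ij∈B

  _∩ₑ_ : EdgeSet G → EdgeSet G → EdgeSet G
  B₁ ∩ₑ B₂ = record
    { mem    = λ i j → mem B₁ i j ∧ mem B₂ i j
    ; memSym = λ i j → cong₂ _∧_ (memSym B₁ i j) (memSym B₂ i j)
    ; sub    = λ i j → sub B₁ i j ∘ ∧-true⇒ˡ
    }

  ∪ₑ-⊇ˡ : (B₁ B₂ : EdgeSet G) (i j : Fin n) → mem B₁ i j ≡ true → mem (B₁ ∪ₑ B₂) i j ≡ true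
  ∪ₑ-⊇ˡ B₁ B₂ i j ij∈B₁ rewrite ij∈B₁ = refl

  ∪ₑ-⊇ʳ : (B₁ B₂ : EdgeSet G) (i j : Fin n) → mem B₂ i j ≡ true → mem (B₁ ∪ₑ B₂) i j ≡ true
  ∪ₑ-⊇ʳ B₁ B₂ i j ij∈B₂ rewrite ij∈B₂ = ∨-zeroʳ (mem B₁ i j)

  ∣∪ₑ∣+∣∩ₑ∣ : (B₁ B₂ : EdgeSet G) → ∣ B₁ ∪ₑ B₂ ∣ₑ + ∣ B₁ ∩ₑ B₂ ∣ₑ ≡ ∣ B₁ ∣ₑ + ∣ B₂ ∣ₑ
  ∣∪ₑ∣+∣∩ₑ∣ B₁ B₂ = begin
    ∣ B₁ ∪ₑ B₂ ∣ₑ + ∣ B₁ ∩ₑ B₂ ∣ₑ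
      ≡⟨ cong₂ _+_ (∣∣ₑ≡sum₂ (B₁ ∪ₑ B₂)) (∣∣ₑ≡sum₂ (B₁ ∩ₑ B₂)) ⟩
    sum₂ (term (B₁ ∪ₑ B₂)) + sum₂ (term (B₁ ∩ₑ B₂))
      ≡⟨ sum₂-distrib-+ (term (B₁ ∪ₑ B₂)) (term (B₁ ∩ₑ B₂)) ⟨
    sum₂ (λ i j → term (B₁ ∪ₑ B₂) i j + term (B₁ ∩ₑ B₂) i j)
      ≡⟨ sum₂-cong (λ i j → 𝟙-∨+𝟙-∧ (mem B₁ i j) (mem B₂ i j) (i ≺ j)) ⟩
    sum₂ (λ i j → term B₁ i j + term B₂ i j)
      ≡⟨ sum₂-distrib-+ (term B₁) (term B₂) ⟩
    sum₂ (term B₁) + sum₂ (term B₂)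
      ≡⟨ cong₂ _+_ (∣∣ₑ≡sum₂ B₁) (∣∣ₑ≡sum₂ B₂) ⟨
    ∣ B₁ ∣ₑ + ∣ B₂ ∣ₑ ∎
    where
    open ≡-Reasoning
    term : EdgeSet G → Fin n → Fin n → ℕ
    term B i j = 𝟙 (mem B i j ∧ i ≺ j)

  ordered-edge⇒1≤∣∣ₑ : (B : EdgeSet G) {i j : Fin n} → mem B i j ≡ true → toℕ i < toℕ j → 1 ≤ ∣ B ∣ₑ
  ordered-edge⇒1≤∣∣ₑ B {i} {j} ij∈B i<j = begin
    1                                    ≡⟨ cong₂ (λ x y → 𝟙 (x ∧ y)) ij∈B (Equivalence.to T-≡ (<⇒<ᵇ i<j)) ⟨
    𝟙 (mem B i j ∧ i ≺ j)                ≤⟨ term≤sum _ j ⟩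
    ∑[ k < n ] 𝟙 (mem B i k ∧ i ≺ k)     ≤⟨ term≤sum (λ a → ∑[ k < n ] 𝟙 (mem B a k ∧ a ≺ k)) i ⟩
    sum₂ (λ a k → 𝟙 (mem B a k ∧ a ≺ k)) ≡⟨ ∣∣ₑ≡sum₂ B ⟨
    ∣ B ∣ₑ                               ∎
    where open ≤-Reasoning

  edge⇒1≤∣∣ₑ : (B : EdgeSet G) {i j : Fin n} → mem B i j ≡ true → 1 ≤ ∣ B ∣ₑ
  edge⇒1≤∣∣ₑ B {i} {j} ij∈B with <-cmp (toℕ i) (toℕ j)
  ... | tri< i<j _ _ = ordered-edge⇒1≤∣∣ₑ B ij∈B i<j
  ... | tri> _ _ j<i = ordered-edge⇒1≤∣∣ₑ B (trans (memSym B j i) ij∈B) j<i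
  ... | tri≈ _ i≡j _ = contradiction (toℕ-injective i≡j) (edge⇒≢ G (sub B i j ij∈B))

  removeEdges-isolates : (B : EdgeSet G) {x : Fin n} →
    (∀ w → adj G x w ≡ true → mem B x w ≡ true) → ∀ w → adj (removeEdges G B) x w ≡ false
  removeEdges-isolates B {x} x-edges∈B w with adj G x w in xw∈G
  ... | false = refl
  ... | true rewrite x-edges∈B w xw∈G = refl

star : ∀ {n} (G : Graph n) → Fin n → EdgeSet G
star G x = record
  { mem    = λ i j → (does (i ≟ x) ∨ does (j ≟ x)) ∧ adj G i j
  ; memSym = λ i j → cong₂ _∧_ (∨-comm (does (i ≟ x)) (does (j ≟ x))) (sym G i j)
  ; sub    = λ i j → ∧-true⇒ʳ
  }

star-∋ˡ : ∀ {n} (G : Graph n) (x w : Fin n) → adj G x w ≡ true → mem (star G x) x w ≡ true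
star-∋ˡ G x w xw∈G rewrite dec-true (x ≟ x) refl = xw∈G

star-∋ʳ : ∀ {n} (G : Graph n) (x w : Fin n) → adj G w x ≡ true → mem (star G x) w x ≡ true
star-∋ʳ G x w wx∈G = trans (memSym (star G x) w x) (star-∋ˡ G x w (trans (sym G x w) wx∈G))

∣star∣ₑ≡deg : ∀ {n} (G : Graph n) (x : Fin n) → ∣ star G x ∣ₑ ≡ deg G x
∣star∣ₑ≡deg {n} G x = begin
  ∣ star G x ∣ₑ
    ≡⟨ ∣∣ₑ≡sum₂ (star G x) ⟩
  sum₂ (λ i j → 𝟙 (mem (star G x) i j ∧ i ≺ j))
    ≡⟨ sum₂-cong split-at-x ⟩
  sum₂ (λ i j → at i (T i j) + at j (T i j))
    ≡⟨ sum₂-distrib-+ (λ i j → at i (T i j)) (λ i j → at j (T i j)) ⟩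
  sum₂ (λ i j → at i (T i j)) + sum₂ (λ i j → at j (T i j))
    ≡⟨ cong₂ _+_ (trans (∑-comm (λ i j → at i (T i j))) (sum-cong-≗ (λ j → sum-at x (λ i → T i j))))
                 (sum-cong-≗ (λ i → sum-at x (T i))) ⟩
  ∑[ j < n ] T x j + ∑[ i < n ] T i x
    ≡⟨ ∑-distrib-+ (T x) (λ j → T j x) ⟨
  ∑[ j < n ] (T x j + T j x)
    ≡⟨ sum-cong-≗ both-orders ⟩
  ∑[ j < n ] 𝟙 (adj G x j)
    ≡⟨ deg≡sum G x ⟨
  deg G x ∎
  where
  open ≡-Reasoning
  T : Fin n → Fin n → ℕ
  T i j = 𝟙 (adj G i j ∧ i ≺ j)
  at : Fin n → ℕ → ℕ
  at i m = if does (i ≟ x) then m else 0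

  split-at-x : ∀ i j → 𝟙 (mem (star G x) i j ∧ i ≺ j) ≡ at i (T i j) + at j (T i j)
  split-at-x i j with i ≟ x | j ≟ x
  ... | yes refl | yes refl rewrite irrefl G i = refl
  ... | yes _    | no _     = ≡.sym (+-identityʳ (T i j))
  ... | no _     | yes _    = refl
  ... | no _     | no _     = refl

  both-orders : ∀ j → T x j + T j x ≡ 𝟙 (adj G x j)
  both-orders j with j ≟ x
  ... | yes refl rewrite irrefl G j = refl
  ... | no j≢x rewrite sym G j x = 𝟙-∧≺+𝟙-∧≻ (adj G x j) (j≢x ∘ ≡.sym)

Isolated : ∀ {n} → Graph n → Fin n → Set
Isolated H x = ∀ w → adj H x w ≡ false

no-edge-at-isolated : ∀ {n} (H : Graph n) {x w : Fin n} → Isolated H x → adj H x w ≢ true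
no-edge-at-isolated H {w = w} x-iso xw∈H = contradiction (trans (≡.sym xw∈H) (x-iso w)) λ ()

isolated⇒2≤ : ∀ {n} (H : Graph n) {f : Fin n → ℕ} {x : Fin n} → IsDRDF H f → Isolated H x → 2 ≤ f x
isolated⇒2≤ H {f} {x} (_ , zero-cond , one-cond) x-iso with f x in fx≡
... | 0 with zero-cond x fx≡
...   | inj₁ (w , _ , _ , xw∈H , _) = contradiction xw∈H (no-edge-at-isolated H x-iso)
...   | inj₂ (w , xw∈H , _)         = contradiction xw∈H (no-edge-at-isolated H x-iso)
isolated⇒2≤ H {f} {x} (_ , zero-cond , one-cond) x-iso | 1 =
  contradiction (proj₁ (proj₂ (one-cond x fx≡))) (no-edge-at-isolated H x-iso)
isolated⇒2≤ H _ _ | suc (suc _) = s≤s (s≤s z≤n)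

redistribute : ∀ {n} → Fin n → Fin n → (Fin n → ℕ) → Fin n → ℕ
redistribute u v f i with i ≟ u | i ≟ v
... | yes _ | _     = 3
... | no _  | yes _ = 0
... | no _  | no _  = f i

redistribute-at-source : ∀ {n} (u v : Fin n) (f : Fin n → ℕ) → redistribute u v f u ≡ 3
redistribute-at-source u v f with u ≟ u
... | yes _  = refl
... | no u≢u = contradiction refl u≢u

redistribute-weight : ∀ {n} {u v : Fin n} (f : Fin n → ℕ) → u ≢ v → 2 ≤ f u → 2 ≤ f v →
  weight (redistribute u v f) < weight f
redistribute-weight {n} {u} {v} f u≢v 2≤fu 2≤fv = +-cancelʳ-≤ 1 _ _ (begin
  suc (weight g) + 1              ≡⟨ ≡.sym (+-suc (weight g) 1) ⟩
  weight g + 2                    ≡⟨ cong₂ _+_ (weight≡sum g) (≡.sym (sum-at v (λ _ → 2))) ⟩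
  sum g + sum (point v 2)         ≡⟨ ∑-distrib-+ g (point v 2) ⟨
  ∑[ i < n ] (g i + point v 2 i)  ≤⟨ sum-mono-≤ pointwise ⟩
  ∑[ i < n ] (f i + point u 1 i)  ≡⟨ ∑-distrib-+ f (point u 1) ⟩
  sum f + sum (point u 1)         ≡⟨ cong₂ _+_ (≡.sym (weight≡sum f)) (sum-at u (λ _ → 1)) ⟩
  weight f + 1                    ∎)
  where
  open ≤-Reasoning
  g : Fin n → ℕ
  g = redistribute u v f
  point : Fin n → ℕ → Fin n → ℕ
  point x c i = if does (i ≟ x) then c else 0
  pointwise : ∀ i → g i + point v 2 i ≤ f i + point u 1 i
  pointwise i with i ≟ u | i ≟ v
  ... | yes refl | yes refl = contradiction refl u≢v
  ... | yes refl | no _     = +-monoˡ-≤ 1 2≤fu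
  ... | no _     | yes refl = subst (2 ≤_) (≡.sym (+-identityʳ (f i))) 2≤fv
  ... | no _     | no _     = ≤-refl

module _ {n} {G H : Graph n} (H⊆G : ∀ i j → adj H i j ≡ true → adj G i j ≡ true)
         {u v : Fin n} (uv∈G : adj G u v ≡ true) (u-iso : Isolated H u) (v-iso : Isolated H v) where

  redistribute-DRDF : ∀ {f} → IsDRDF H f → IsDRDF G (redistribute u v f)
  redistribute-DRDF {f} (f≤3 , zero-cond , one-cond) = g≤3 , g-zero-cond , g-one-cond
    where
    g : Fin n → ℕ
    g = redistribute u v f

    g≡f-at-H-neighbour : ∀ {x w} → adj H x w ≡ true → g w ≡ f w
    g≡f-at-H-neighbour {x} {w} xw∈H with w ≟ u | w ≟ v
    ... | yes refl | _        = contradiction (trans (sym H w x) xw∈H) (no-edge-at-isolated H u-iso)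
    ... | no _     | yes refl = contradiction (trans (sym H w x) xw∈H) (no-edge-at-isolated H v-iso)
    ... | no _     | no _     = refl

    g≤3 : ∀ x → g x ≤ 3
    g≤3 x with x ≟ u | x ≟ v
    ... | yes _ | _     = ≤-refl
    ... | no _  | yes _ = z≤n
    ... | no _  | no _  = f≤3 x

    g-zero-cond : ∀ x → g x ≡ 0 →
      (∃ λ a → ∃ λ b → a ≢ b × adj G x a ≡ true × adj G x b ≡ true × g a ≡ 2 × g b ≡ 2)
      ⊎ (∃ λ w → adj G x w ≡ true × g w ≡ 3)
    g-zero-cond x gx≡0 with x ≟ u | x ≟ v
    ... | yes _ | _        = contradiction gx≡0 λ ()
    ... | no _  | yes refl = inj₂ (u , trans (sym G x u) uv∈G , redistribute-at-source u x f)
    ... | no _  | no _ with zero-cond x gx≡0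
    ...   | inj₁ (a , b , a≢b , xa∈H , xb∈H , fa≡2 , fb≡2) =
            inj₁ (a , b , a≢b , H⊆G x a xa∈H , H⊆G x b xb∈H ,
                  trans (g≡f-at-H-neighbour xa∈H) fa≡2 , trans (g≡f-at-H-neighbour xb∈H) fb≡2)
    ...   | inj₂ (w , xw∈H , fw≡3) = inj₂ (w , H⊆G x w xw∈H , trans (g≡f-at-H-neighbour xw∈H) fw≡3)

    g-one-cond : ∀ x → g x ≡ 1 → ∃ λ w → adj G x w ≡ true × 2 ≤ g w
    g-one-cond x gx≡1 with x ≟ u | x ≟ v
    ... | yes _ | _     = contradiction gx≡1 λ ()
    ... | no _  | yes _ = contradiction gx≡1 λ ()
    ... | no _  | no _ with one-cond x gx≡1
    ...   | w , xw∈H , 2≤fw = w , H⊆G x w xw∈H , subst (2 ≤_) (≡.sym (g≡f-at-H-neighbour xw∈H)) 2≤fw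

  γdR-increases : ∀ k k' → IsγdR G k → IsγdR H k' → k < k'
  γdR-increases k k' (_ , k-minimal) ((f , f-DRDF , wf≡k') , _) = begin-strict
    k                            ≤⟨ k-minimal (redistribute u v f) (redistribute-DRDF f-DRDF) ⟩
    weight (redistribute u v f)  <⟨ redistribute-weight f (edge⇒≢ G uv∈G)
                                      (isolated⇒2≤ H f-DRDF u-iso) (isolated⇒2≤ H f-DRDF v-iso) ⟩
    weight f                     ≡⟨ wf≡k' ⟩
    k'                           ∎
    where open ≤-Reasoning

bondage≤deg+deg∸1 : ∀ {n} (G : Graph n) {u v : Fin n} → adj G u v ≡ true →
  BondageAtMost G (deg G u + deg G v ∸ 1)
bondage≤deg+deg∸1 G {u} {v} uv∈G =
  B , m+n≤o⇒m≤o∸n ∣ B ∣ₑ ∣B∣ₑ+1≤deg+deg ,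
  γdR-increases {G = G} {H = removeEdges G B} (λ i j → ∧-true⇒ˡ) uv∈G
    (removeEdges-isolates B λ w uw∈G → ∪ₑ-⊇ˡ (star G u) (star G v) u w (star-∋ˡ G u w uw∈G))
    (removeEdges-isolates B λ w vw∈G → ∪ₑ-⊇ʳ (star G u) (star G v) v w (star-∋ˡ G v w vw∈G))
  where
  B : EdgeSet G
  B = star G u ∪ₑ star G v
  uv∈star-u∩star-v : mem (star G u ∩ₑ star G v) u v ≡ true
  uv∈star-u∩star-v = cong₂ _∧_ (star-∋ˡ G u v uv∈G) (star-∋ʳ G v u uv∈G)
  ∣B∣ₑ+1≤deg+deg : ∣ B ∣ₑ + 1 ≤ deg G u + deg G v
  ∣B∣ₑ+1≤deg+deg = begin
    ∣ B ∣ₑ + 1                           ≤⟨ +-monoʳ-≤ ∣ B ∣ₑ (edge⇒1≤∣∣ₑ (star G u ∩ₑ star G v) {u} {v} uv∈star-u∩star-v) ⟩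
    ∣ B ∣ₑ + ∣ star G u ∩ₑ star G v ∣ₑ  ≡⟨ ∣∪ₑ∣+∣∩ₑ∣ (star G u) (star G v) ⟩
    ∣ star G u ∣ₑ + ∣ star G v ∣ₑ       ≡⟨ cong₂ _+_ (∣star∣ₑ≡deg G u) (∣star∣ₑ≡deg G v) ⟩
    deg G u + deg G v                   ∎
    where open ≤-Reasoning

BondageAtMost-mono : ∀ {n} {G : Graph n} {m m′ : ℕ} → m ≤ m′ → BondageAtMost G m → BondageAtMost G m′
BondageAtMost-mono m≤m′ (B , ∣B∣ₑ≤m , increases) = B , ≤-trans ∣B∣ₑ≤m m≤m′ , increases

deg≤Δ : ∀ {n} (G : Graph n) (x : Fin n) → deg G x ≤ Δ G
deg≤Δ {n} G x = All.lookup (All.map⁻ degs≤Δ) (∈-allFin x)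
  where
  degs≤Δ : All (_≤ Δ G) (map (deg G) (allFin n))
  degs≤Δ = foldr-forcesᵇ (λ a b a⊔b≤Δ → m⊔n≤o⇒m≤o a b a⊔b≤Δ , m⊔n≤o⇒n≤o a b a⊔b≤Δ) 0 _ ≤-refl

∃deg≤δ : ∀ {m} (G : Graph (suc m)) → ∃ λ x → deg G x ≤ δ G
∃deg≤δ {m} G with foldr-selective ⊓-sel (Δ G) (map (deg G) (allFin (suc m)))
... | inj₁ δ≡Δ    = zero , subst (deg G zero ≤_) (≡.sym δ≡Δ) (deg≤Δ G zero)
... | inj₂ δ∈degs with ∈-map⁻ (deg G) δ∈degs
...   | x , _ , δ≡deg-x = x , ≤-reflexive (≡.sym δ≡deg-x)

reach-other⇒neighbour : ∀ {n} {G : Graph n} {x y : Fin n} → Reach G x y → x ≢ y → ∃ λ w → adj G x w ≡ true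
reach-other⇒neighbour here                  x≢x = contradiction refl x≢x
reach-other⇒neighbour (step {w = w} xw∈G _) _   = w , xw∈G

connected⇒neighbour : ∀ {m} (G : Graph (suc (suc m))) → Connected G → ∀ x → ∃ λ w → adj G x w ≡ true
connected⇒neighbour G G-connected zero    = reach-other⇒neighbour (G-connected zero (suc zero)) λ ()
connected⇒neighbour G G-connected (suc x) = reach-other⇒neighbour (G-connected (suc x) zero) λ ()

corollary3p6 : ∀ (n : ℕ) (G : Graph n) → 2 ≤ n → Connected G →
    BondageAtMost G (Δ G + δ G ∸ 1)
corollary3p6 (suc (suc m)) G (s≤s (s≤s z≤n)) G-connected with ∃deg≤δ G
... | u , deg-u≤δ with connected⇒neighbour G G-connected u
...   | v , uv∈G = BondageAtMost-mono (∸-monoˡ-≤ 1 deg+deg≤Δ+δ) (bondage≤deg+deg∸1 G uv∈G)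
  where
  deg+deg≤Δ+δ : deg G u + deg G v ≤ Δ G + δ G
  deg+deg≤Δ+δ = subst (deg G u + deg G v ≤_) (+-comm (δ G) (Δ G)) (+-mono-≤ deg-u≤δ (deg≤Δ G v))
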